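{- For every $n \geq 1$, $|E_n| = 2^{3^{n-1}} \cdot 3^{(3^n-1)/2}$.
   Context: $T_n$ is the regular ternary rooted tree with $n$ levels: vertices at level $i$ are sequences $(\ell_1,\dots,\ell_i)$ with $\ell_j\in\{1,2,3\}$, and $(\ell_1,\dots,\ell_i)$ is joined to $(\ell_1,\dots,\ell_{i+1})$. $\mathrm{Aut}(T_n)$ is identified with $\mathrm{Aut}(T_{n-1})\wr\mathrm{Aut}(T_1)$: $((a_1,a_2,a_3),b)$ sends $(i,\ell_2,\dots,\ell_k)$ to $(b(i),a_i(\ell_2,\dots,\ell_k))$. $\mathrm{sgn}(\sigma)$ is the sign of the permutation of leaves induced by $\sigma$, and $\mathrm{sgn}_2(\sigma)$ is the sign of the restriction of $\sigma$ to the subtree of vertices of level $\le2$. Define $E_1=\mathrm{Aut}(T_1)\cong\mathfrak S_3$ and, for $n\ge2$, $E_n=\{\sigma=((a_1,a_2,a_3),b)\in\mathrm{Aut}(T_n): a_1,a_2,a_3\in E_{n-1},\ \mathrm{sgn}_2(\sigma)=1\}$. -}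

module Defs where

open import Data.Nat using (ℕ; zero; suc; _+_; _*_; _^_; _<ᵇ_)
open import Data.Nat.DivMod using (_mod_; _/_)
open import Data.Nat.Properties using ()
open import Data.Fin using (Fin; toℕ; _≟_)
open import Data.Vec using (Vec; []; _∷_; lookup)
open import Data.Bool using (Bool; true; false; not; _∧_; if_then_else_; T)
open import Data.List using (List; upTo; map)
open import Data.Nat.ListAction using (sum)
open import Data.Product using (Σ; _×_; _,_)
open import Data.Unit using (⊤; tt)
open import Relation.Nullary.Decidable using (⌊_⌋)

-- The symmetric group S₃ = Aut(T₁) acting on {1,2,3} (encoded as Fin 3).
-- A permutation is given by its vector of images (v[0],v[1],v[2]),
-- required to be pairwise distinct (a Boolean check, so proofs are unique).

distinct3 : Vec (Fin 3) 3 → Bool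
distinct3 (x ∷ y ∷ z ∷ []) = not ⌊ x ≟ y ⌋ ∧ not ⌊ x ≟ z ⌋ ∧ not ⌊ y ≟ z ⌋

S3 : Set
S3 = Σ (Vec (Fin 3) 3) (λ v → T (distinct3 v))

applyS3 : S3 → Fin 3 → Fin 3
applyS3 (v , _) i = lookup v i

-- Aut(T_n), via the identification Aut(T_n) = Aut(T_{n-1}) ≀ Aut(T_1):
-- an element is ((a₁,a₂,a₃), b).  T₀ is a single vertex, Aut(T₀) trivial.

Aut : ℕ → Set
Aut zero    = ⊤
Aut (suc n) = (Aut n × Aut n × Aut n) × S3

pick : ∀ {n} → Aut n × Aut n × Aut n → Fin 3 → Aut n
pick (a₁ , a₂ , a₃) Fin.zero             = a₁
pick (a₁ , a₂ , a₃) (Fin.suc Fin.zero)   = a₂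
pick (a₁ , a₂ , a₃) (Fin.suc (Fin.suc Fin.zero)) = a₃

-- Leaves of T_n are sequences (ℓ₁,…,ℓₙ); ((a₁,a₂,a₃),b) sends
-- (i,ℓ₂,…,ℓₙ) to (b(i), a_i(ℓ₂,…,ℓₙ)).
act : ∀ {n} → Aut n → Vec (Fin 3) n → Vec (Fin 3) n
act {zero}  _         []         = []
act {suc n} (as , b) (i ∷ rest) = applyS3 b i ∷ act (pick as i) rest

-- Sign of the permutation of leaves.  Leaves are numbered 0 … 3ⁿ-1
-- (base-3 digits); the sign of a permutation f of {0,…,N-1} is
-- (-1)^(number of inversions), encoded as a Bool (true = +1).

encode : ∀ {n} → Vec (Fin 3) n → ℕ
encode []         = 0
encode (i ∷ rest) = toℕ i + 3 * encode rest

decode : ∀ n → ℕ → Vec (Fin 3) n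
decode zero    m = []
decode (suc n) m = (m mod 3) ∷ decode n (m / 3)

leafPerm : ∀ {n} → Aut n → ℕ → ℕ
leafPerm {n} σ m = encode (act σ (decode n m))

inversions : ℕ → (ℕ → ℕ) → ℕ
inversions N f =
  sum (map (λ j → sum (map (λ i → if f j <ᵇ f i then 1 else 0) (upTo j))) (upTo N))

even : ℕ → Bool
even zero    = true
even (suc n) = not (even n)

sgnPlus : ∀ {n} → Aut n → Bool
sgnPlus {n} σ = even (inversions (3 ^ n) (leafPerm σ))

restrict : ∀ k {n} → Aut (k + n) → Aut k
restrict zero    _                   = tt
restrict (suc k) ((a₁ , a₂ , a₃) , b) = (restrict k a₁ , restrict k a₂ , restrict k a₃) , b

sgn₂Plus : ∀ {n} → Aut (2 + n) → Bool
sgn₂Plus σ = sgnPlus (restrict 2 σ)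

-- Membership in E_n (n ≥ 1; the value at n = 0 is irrelevant).

InE : ∀ n → Aut n → Set
InE zero          _ = ⊤
InE (suc zero)    _ = ⊤
InE (suc (suc n)) σ@((a₁ , a₂ , a₃) , b) =
  InE (suc n) a₁ × InE (suc n) a₂ × InE (suc n) a₃ × T (sgn₂Plus σ)

E : ℕ → Set
E n = Σ (Aut n) (InE n)

module Submission where

-- Write signs ±1 as Booleans and let sign(b) be the sign of b ∈ S₃.
-- (1) S₃ ↔ Bool × Fin 3 by b ↦ (sign b, image of the first point).
-- (2) The level-2 sign of ((a₁,a₂,a₃),b) is the product of the signs of the
--     tops of a₁, a₂, a₃ and of b (a finite check over S₃⁴).
-- (3) Call a type A with sign function s "sign-split" over H when A ↔ Bool × H
--     with first coordinate s.  If A is sign-split over H and B over K, then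
--     the quadruples (x₁,x₂,x₃,b) ∈ A³ × B whose signs multiply to +1 are
--     sign-split over A × A × H × K: the sign of x₃ is forced by the others.
-- (4) By (2), E_{n+2} is exactly such a set of quadruples over A = E_{n+1},
--     B = S₃, so by induction E_{n+1} is sign-split over an explicit type
--     Free n, of size h_n with h₀ = 3, h_{n+1} = (2h_n)² h_n · 3.
-- (5) Solving this recurrence gives 2h_n = 2^(3^n) · 3^((3^(n+1) - 1)/2).

open import Defs
open import Data.Nat using (ℕ; _≤_; _^_; _*_; _∸_; _/_)
open import Data.Fin using (Fin)
open import Function.Bundles using (_↔_)

open import Data.Nat using (zero; suc; _+_)
open import Data.Nat.Properties using (^-distribˡ-+-*; ^-*-assoc; *-comm)
open import Data.Nat.DivMod using (m*n/n≡m)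
open import Data.Nat.Tactic.RingSolver using (solve-∀)
open import Data.Fin using (zero; suc)
import Data.Fin.Properties as Fin
open import Data.Vec using ([]; _∷_)
open import Data.Bool using (Bool; true; false; not; T)
import Data.Bool.Properties as Bool
open import Data.Product using (Σ; _×_; _,_; proj₁; proj₂)
open import Data.Unit using (tt)
open import Level using (0ℓ)
open import Relation.Nullary.Decidable using (Dec; map′; _×-dec_; toWitness)
open import Relation.Unary using (Pred; Decidable)
open import Relation.Binary.PropositionalEquality
open import Function.Bundles using (Inverse; mk↔ₛ′)
open import Function.Properties.Inverse using (↔-trans; ↔-sym; ↔-refl)
open import Data.Product.Function.NonDependent.Propositional using (_×-↔_)

open Inverse using (to; from; strictlyInverseˡ; strictlyInverseʳ)

-- Product of signs ±1, encoded as Booleans with true = +1 (as in sgnPlus).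
infixl 7 _·_
_·_ : Bool → Bool → Bool
true  · y = y
false · y = not y

·-solve : ∀ u s t → T (u · s · t) → s ≡ u · t
·-solve true  true  true  _ = refl
·-solve true  false false _ = refl
·-solve false true  false _ = refl
·-solve false false true  _ = refl

·-cancel : ∀ u t → T (u · (u · t) · t)
·-cancel true  true  = tt
·-cancel true  false = tt
·-cancel false true  = tt
·-cancel false false = tt

sign : S3 → Bool
sign b = sgnPlus {1} ((tt , tt , tt) , b)

perm : Bool × Fin 3 → S3
perm (true  , zero)           = (zero ∷ suc zero ∷ suc (suc zero) ∷ []) , tt
perm (true  , suc zero)       = (suc zero ∷ suc (suc zero) ∷ zero ∷ []) , tt
perm (true  , suc (suc zero)) = (suc (suc zero) ∷ zero ∷ suc zero ∷ []) , tt
perm (false , zero)           = (zero ∷ suc (suc zero) ∷ suc zero ∷ []) , tt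
perm (false , suc zero)       = (suc zero ∷ zero ∷ suc (suc zero) ∷ []) , tt
perm (false , suc (suc zero)) = (suc (suc zero) ∷ suc zero ∷ zero ∷ []) , tt

S3-elim : (P : S3 → Set) → (∀ p → P (perm p)) → ∀ c → P c
S3-elim P h ((zero ∷ suc zero ∷ suc (suc zero) ∷ []) , _) = h (true  , zero)
S3-elim P h ((suc zero ∷ suc (suc zero) ∷ zero ∷ []) , _) = h (true  , suc zero)
S3-elim P h ((suc (suc zero) ∷ zero ∷ suc zero ∷ []) , _) = h (true  , suc (suc zero))
S3-elim P h ((zero ∷ suc (suc zero) ∷ suc zero ∷ []) , _) = h (false , zero)
S3-elim P h ((suc zero ∷ zero ∷ suc (suc zero) ∷ []) , _) = h (false , suc zero)
S3-elim P h ((suc (suc zero) ∷ suc zero ∷ zero ∷ []) , _) = h (false , suc (suc zero))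
S3-elim P h ((zero ∷ zero ∷ _ ∷ []) , ())
S3-elim P h ((suc zero ∷ suc zero ∷ _ ∷ []) , ())
S3-elim P h ((suc (suc zero) ∷ suc (suc zero) ∷ _ ∷ []) , ())
S3-elim P h ((zero ∷ suc zero ∷ zero ∷ []) , ())
S3-elim P h ((zero ∷ suc zero ∷ suc zero ∷ []) , ())
S3-elim P h ((zero ∷ suc (suc zero) ∷ zero ∷ []) , ())
S3-elim P h ((zero ∷ suc (suc zero) ∷ suc (suc zero) ∷ []) , ())
S3-elim P h ((suc zero ∷ zero ∷ zero ∷ []) , ())
S3-elim P h ((suc zero ∷ zero ∷ suc zero ∷ []) , ())
S3-elim P h ((suc zero ∷ suc (suc zero) ∷ suc zero ∷ []) , ())
S3-elim P h ((suc zero ∷ suc (suc zero) ∷ suc (suc zero) ∷ []) , ())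
S3-elim P h ((suc (suc zero) ∷ zero ∷ zero ∷ []) , ())
S3-elim P h ((suc (suc zero) ∷ zero ∷ suc (suc zero) ∷ []) , ())
S3-elim P h ((suc (suc zero) ∷ suc zero ∷ suc zero ∷ []) , ())
S3-elim P h ((suc (suc zero) ∷ suc zero ∷ suc (suc zero) ∷ []) , ())

all-Bool×Fin3? : ∀ {P : Pred (Bool × Fin 3) 0ℓ} → Decidable P → Dec (∀ p → P p)
all-Bool×Fin3? P? =
  map′ (λ (even , odd) → λ { (true , i) → even i ; (false , i) → odd i })
       (λ all → (λ i → all (true , i)) , (λ i → all (false , i)))
       (Fin.all? (λ i → P? (true , i)) ×-dec Fin.all? (λ i → P? (false , i)))

signAndImage : S3 → Bool × Fin 3
signAndImage c = sign c , applyS3 c zero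

signAndImage-perm : ∀ p → signAndImage (perm p) ≡ p
signAndImage-perm (true  , zero)           = refl
signAndImage-perm (true  , suc zero)       = refl
signAndImage-perm (true  , suc (suc zero)) = refl
signAndImage-perm (false , zero)           = refl
signAndImage-perm (false , suc zero)       = refl
signAndImage-perm (false , suc (suc zero)) = refl

S3↔Bool×Fin3 : S3 ↔ (Bool × Fin 3)
S3↔Bool×Fin3 = mk↔ₛ′ signAndImage perm signAndImage-perm
  (S3-elim _ (λ p → cong perm (signAndImage-perm p)))

level2 : S3 → S3 → S3 → S3 → Aut 2
level2 c₁ c₂ c₃ b = (((tt , tt , tt) , c₁) , ((tt , tt , tt) , c₂) , ((tt , tt , tt) , c₃)) , b

-- sgn(((c₁,c₂,c₃),b)) = sgn c₁ · sgn c₂ · sgn c₃ · sgn b on T₂ (sgn b enters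
-- cubed, i.e. once), verified over all 6⁴ cases.
-- (Opaque, so that later definitions never unfold the finite check.)
opaque
  sign-level2 : ∀ c₁ c₂ c₃ b → sgnPlus (level2 c₁ c₂ c₃ b) ≡ sign c₁ · sign c₂ · sign c₃ · sign b
  sign-level2 =
    S3-elim _ λ p₁ → S3-elim _ λ p₂ → S3-elim _ λ p₃ → S3-elim _ λ p₄ → table p₁ p₂ p₃ p₄
    where
    table : ∀ p₁ p₂ p₃ p₄ → sgnPlus (level2 (perm p₁) (perm p₂) (perm p₃) (perm p₄))
                          ≡ sign (perm p₁) · sign (perm p₂) · sign (perm p₃) · sign (perm p₄)
    table = toWitness {a? = all-Bool×Fin3? λ p₁ → all-Bool×Fin3? λ p₂ →
                            all-Bool×Fin3? λ p₃ → all-Bool×Fin3? λ p₄ →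
                            sgnPlus (level2 (perm p₁) (perm p₂) (perm p₃) (perm p₄))
                              Bool.≟ sign (perm p₁) · sign (perm p₂) · sign (perm p₃) · sign (perm p₄)} tt

-- sgn₂ of ((a₁,a₂,a₃),b) only sees the tops of the aᵢ, so it is their sign product.
sgn₂-multiplicative : ∀ {n} (a₁ a₂ a₃ : Aut (suc n)) b →
  sgn₂Plus ((a₁ , a₂ , a₃) , b) ≡ sign (proj₂ a₁) · sign (proj₂ a₂) · sign (proj₂ a₃) · sign b
sgn₂-multiplicative a₁ a₂ a₃ b = sign-level2 (proj₂ a₁) (proj₂ a₂) (proj₂ a₃) b

record SignSplit (A : Set) (s : A → Bool) (H : Set) : Set where
  field
    iso      : A ↔ (Bool × H)
    sign-fst : ∀ a → proj₁ (to iso a) ≡ s a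

  sign-from : ∀ q h → s (from iso (q , h)) ≡ q
  sign-from q h = trans (sym (sign-fst (from iso (q , h)))) (cong proj₁ (strictlyInverseˡ iso (q , h)))

open SignSplit

SignSplit-transport : ∀ {A B H s t} (φ : A ↔ B) → (∀ a → t (to φ a) ≡ s a) →
                      SignSplit B t H → SignSplit A s H
SignSplit-transport φ preserves split = record
  { iso      = ↔-trans φ (iso split)
  ; sign-fst = λ a → trans (sign-fst split (to φ a)) (preserves a)
  }

Balanced : (A B : Set) → (A → Bool) → (B → Bool) → Set
Balanced A B s t = Σ ((A × A × A) × B) λ ((x₁ , x₂ , x₃) , b) → T (s x₁ · s x₂ · s x₃ · t b)

Balanced-≡ : ∀ {A B s t} {w w′ : Balanced A B s t} → proj₁ w ≡ proj₁ w′ → w ≡ w′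
Balanced-≡ {w = _ , p} {_ , p′} refl = cong (_ ,_) (Bool.T-irrelevant p p′)

-- The key counting step: in a balanced quadruple the sign of x₃ is forced by
-- x₁, x₂ and b, so only the H-part of x₃ is free.  The sign of the quadruple
-- is that of its B-component.
balanced-split : ∀ {A B H K s t} → SignSplit A s H → SignSplit B t K →
                 SignSplit (Balanced A B s t) (λ w → t (proj₂ (proj₁ w))) ((A × A × H) × K)
balanced-split {A} {B} {H} {K} {s} {t} splitA splitB = record
  { iso      = mk↔ₛ′ forward backward forward-backward backward-forward
  ; sign-fst = λ w → sign-fst splitB (proj₂ (proj₁ w))
  }
  where
  φ = iso splitA
  ψ = iso splitB

  forward : Balanced A B s t → Bool × ((A × A × H) × K)
  forward (((x₁ , x₂ , x₃) , b) , _) =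
    proj₁ (to ψ b) , ((x₁ , x₂ , proj₂ (to φ x₃)) , proj₂ (to ψ b))

  forced : A → A → Bool → Bool
  forced x₁ x₂ q = s x₁ · s x₂ · q

  backward : Bool × ((A × A × H) × K) → Balanced A B s t
  backward (q , ((x₁ , x₂ , h) , k)) =
    ((x₁ , x₂ , from φ (forced x₁ x₂ q , h)) , from ψ (q , k)) ,
    subst T (sym (cong₂ (λ c d → s x₁ · s x₂ · c · d)
                        (sign-from splitA (forced x₁ x₂ q) h) (sign-from splitB q k)))
            (·-cancel (s x₁ · s x₂) q)

  forward-backward : ∀ y → forward (backward y) ≡ y
  forward-backward (q , ((x₁ , x₂ , h) , k)) =
    cong₂ (λ (q′ , k′) h′ → q′ , ((x₁ , x₂ , h′) , k′))
          (strictlyInverseˡ ψ (q , k)) (cong proj₂ (strictlyInverseˡ φ (forced x₁ x₂ q , h)))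

  backward-forward : ∀ w → backward (forward w) ≡ w
  backward-forward (((x₁ , x₂ , x₃) , b) , balanced) =
    Balanced-≡ {s = s} {t = t} (cong₂ (λ x b′ → (x₁ , x₂ , x) , b′) x₃-recovered (strictlyInverseʳ ψ b))
    where
    x₃-sign : proj₁ (to φ x₃) ≡ forced x₁ x₂ (proj₁ (to ψ b))
    x₃-sign = begin
      proj₁ (to φ x₃)             ≡⟨ sign-fst splitA x₃ ⟩
      s x₃                        ≡⟨ ·-solve (s x₁ · s x₂) (s x₃) (t b) balanced ⟩
      forced x₁ x₂ (t b)          ≡⟨ cong (forced x₁ x₂) (sym (sign-fst splitB b)) ⟩
      forced x₁ x₂ (proj₁ (to ψ b)) ∎
      where open ≡-Reasoning
    x₃-recovered : from φ (forced x₁ x₂ (proj₁ (to ψ b)) , proj₂ (to φ x₃)) ≡ x₃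
    x₃-recovered = trans (cong (λ q → from φ (q , proj₂ (to φ x₃))) (sym x₃-sign)) (strictlyInverseʳ φ x₃)

topSign : ∀ n → E (suc n) → Bool
topSign n σ = sign (proj₂ (proj₁ σ))

S3-split : SignSplit S3 sign (Fin 3)
S3-split = record { iso = S3↔Bool×Fin3 ; sign-fst = λ _ → refl }

E₁↔S3 : E 1 ↔ S3
E₁↔S3 = mk↔ₛ′ (λ σ → proj₂ (proj₁ σ)) (λ b → ((tt , tt , tt) , b) , tt) (λ _ → refl) (λ _ → refl)

-- By multiplicativity of sgn₂, E_{n+2} is the set of balanced quadruples over E_{n+1} and S₃.
E-unfold : ∀ n → E (2 + n) ↔ Balanced (E (suc n)) S3 (topSign n) sign
E-unfold n = mk↔ₛ′ forward backward
  (λ _ → Balanced-≡ {s = topSign n} {t = sign} refl)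
  (λ { (σ , e₁ , e₂ , e₃ , p) → cong (λ p′ → σ , e₁ , e₂ , e₃ , p′) (Bool.T-irrelevant _ p) })
  where
  forward : E (2 + n) → Balanced (E (suc n)) S3 (topSign n) sign
  forward (((a₁ , a₂ , a₃) , b) , e₁ , e₂ , e₃ , p) =
    (((a₁ , e₁) , (a₂ , e₂) , (a₃ , e₃)) , b) , subst T (sgn₂-multiplicative a₁ a₂ a₃ b) p

  backward : Balanced (E (suc n)) S3 (topSign n) sign → E (2 + n)
  backward ((((a₁ , e₁) , (a₂ , e₂) , (a₃ , e₃)) , b) , p) =
    ((a₁ , a₂ , a₃) , b) , e₁ , e₂ , e₃ , subst T (sym (sgn₂-multiplicative a₁ a₂ a₃ b)) p

-- The free part of E_{n+1} once its top sign is fixed.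
Free : ℕ → Set
Free zero    = Fin 3
Free (suc n) = (E (suc n) × E (suc n) × Free n) × Fin 3

E-split : ∀ n → SignSplit (E (suc n)) (topSign n) (Free n)
E-split zero    = SignSplit-transport E₁↔S3 (λ _ → refl) S3-split
E-split (suc n) = SignSplit-transport (E-unfold n) (λ _ → refl) (balanced-split (E-split n) S3-split)

×-Fin : ∀ {A B : Set} {m n} → A ↔ Fin m → B ↔ Fin n → (A × B) ↔ Fin (m * n)
×-Fin f g = ↔-trans (f ×-↔ g) (↔-sym Fin.*↔×)

freeCount : ℕ → ℕ
freeCount zero    = 3
freeCount (suc n) = ((2 * freeCount n) * ((2 * freeCount n) * freeCount n)) * 3

E↔Fin : ∀ n → E (suc n) ↔ Fin (2 * freeCount n)
Free↔Fin : ∀ n → Free n ↔ Fin (freeCount n)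

E↔Fin n = ↔-trans (iso (E-split n)) (×-Fin (↔-sym Fin.2↔Bool) (Free↔Fin n))

Free↔Fin zero    = ↔-refl
Free↔Fin (suc n) = ×-Fin (×-Fin (E↔Fin n) (×-Fin (E↔Fin n) (Free↔Fin n))) ↔-refl

exponent3 : ℕ → ℕ
exponent3 zero    = 1
exponent3 (suc n) = exponent3 n * 3 + 1

-- 3^(n+1) = 2kₙ + 1, i.e. kₙ = (3^(n+1) - 1)/2.
exponent3-closed : ∀ n → (3 ^ suc n ∸ 1) / 2 ≡ exponent3 n
exponent3-closed n = subst (λ m → (m ∸ 1) / 2 ≡ exponent3 n) (sym (odd-power n)) (m*n/n≡m (exponent3 n) 2)
  where
  odd-power : ∀ n → 3 ^ suc n ≡ 1 + exponent3 n * 2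
  odd-power zero    = refl
  odd-power (suc n) = trans (cong (3 *_) (odd-power n)) (step (exponent3 n))
    where
    step : ∀ k → 3 * (1 + k * 2) ≡ 1 + (k * 3 + 1) * 2
    step = solve-∀

count-closed : ∀ n → 2 * freeCount n ≡ 2 ^ (3 ^ n) * 3 ^ exponent3 n
count-closed zero    = refl
count-closed (suc n) = begin
  2 * freeCount (suc n)                       ≡⟨ cube (freeCount n) ⟩
  (2 * freeCount n) ^ 3 * 3                   ≡⟨ cong (λ x → x ^ 3 * 3) (count-closed n) ⟩
  (2 ^ (3 ^ n) * 3 ^ exponent3 n) ^ 3 * 3     ≡⟨ distribute (2 ^ (3 ^ n)) (3 ^ exponent3 n) ⟩
  (2 ^ (3 ^ n)) ^ 3 * ((3 ^ exponent3 n) ^ 3 * 3)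
    ≡⟨ cong₂ _*_ (^-*-assoc 2 (3 ^ n) 3) (cong (_* 3) (^-*-assoc 3 (exponent3 n) 3)) ⟩
  2 ^ (3 ^ n * 3) * (3 ^ (exponent3 n * 3) * 3)
    ≡⟨ cong₂ _*_ (cong (2 ^_) (*-comm (3 ^ n) 3)) (sym (^-distribˡ-+-* 3 (exponent3 n * 3) 1)) ⟩
  2 ^ (3 ^ suc n) * 3 ^ exponent3 (suc n)     ∎
  where
  open ≡-Reasoning
  -- x ^ 3 unfolds to x * (x * (x * 1)); the solver is given the unfolded form
  cube : ∀ h → 2 * (((2 * h) * ((2 * h) * h)) * 3) ≡ (2 * h) * ((2 * h) * ((2 * h) * 1)) * 3
  cube = solve-∀
  distribute : ∀ a b → (a * b) * ((a * b) * ((a * b) * 1)) * 3 ≡ (a * (a * (a * 1))) * ((b * (b * (b * 1))) * 3)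
  distribute = solve-∀

proposition2p2 : (n : ℕ) → 1 ≤ n → E n ↔ Fin (2 ^ (3 ^ (n ∸ 1)) * 3 ^ ((3 ^ n ∸ 1) / 2))
proposition2p2 (suc n) _ = subst (λ m → E (suc n) ↔ Fin m) size (E↔Fin n)
  where
  size : 2 * freeCount n ≡ 2 ^ (3 ^ n) * 3 ^ ((3 ^ suc n ∸ 1) / 2)
  size = trans (count-closed n) (cong (λ e → 2 ^ (3 ^ n) * 3 ^ e) (sym (exponent3-closed n)))
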